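{- Let $m_1,m_2$ be positive integers and let $M$ be an alignment of a string of $m_1$ letters with a string of $m_2$ letters. Then $M$ can be augmented if and only if its conventional representation contains alternate skips.
   Context: An alignment (up to the equivalence identifying alignments matching the same letters) is a set $M=\{(x_1,y_1),\dots,(x_k,y_k)\}\subseteq[m_1]\times[m_2]$ (with $[m]=\{1,\dots,m\}$, $k\ge 0$) of matched pairs, where $x_1<\dots<x_k$ and $y_1<\dots<y_k$; i.e. the graph of an order-preserving injective map from a subset of $[m_1]$ (positions in the first string) to $[m_2]$ (positions in the second string). $M$ can be augmented if there is a pair $(x,y)\notin M$ such that $M\cup\{(x,y)\}$ is again an alignment. The conventional representation of $M$ is the two-row array built as follows: set $x_0=y_0=0$, $x_{k+1}=m_1+1$, $y_{k+1}=m_2+1$; for $j=0,\dots,k$, in the gap between the $j$-th and $(j+1)$-st matched pairs one first writes one column for each unmatched letter $x_j+1,\dots,x_{j+1}-1$ of the first string (that letter on top, a skip symbol "$-$" below), then one column for each unmatched letter $y_j+1,\dots,y_{j+1}-1$ of the second string (a skip "$-$" on top, that letter below), and then (if $j<k$) the column containing the matched pair $(x_{j+1},y_{j+1})$. The representation contains alternate skips if some column with a letter of the first string above a skip is immediately followed by a column with a skip above a letter of the second string. -}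

module Defs where

open import Data.Nat using (ℕ; zero; suc; _+_; _∸_; _<_; _≤_)
open import Data.Product using (_×_; _,_; proj₁; proj₂; ∃; ∃-syntax)
open import Data.List using (List; []; _∷_; _++_; map)
open import Data.List.Relation.Unary.All using (All)
open import Data.List.Relation.Unary.Linked using (Linked)
open import Data.List.Membership.Propositional using (_∈_; _∉_)
open import Relation.Binary.PropositionalEquality using (_≡_)
open import Function.Bundles using (_⇔_)

-- A matched pair (x , y): position x in the first string, y in the second.
Pair : Set
Pair = ℕ × ℕ

InRange : ℕ → ℕ → Pair → Set
InRange m₁ m₂ (x , y) = (1 ≤ x × x ≤ m₁) × (1 ≤ y × y ≤ m₂)

Before : Pair → Pair → Set
Before (x , y) (x′ , y′) = (x < x′) × (y < y′)

-- An alignment M = {(x₁,y₁),…,(x_k,y_k)} ⊆ [m₁]×[m₂] with x₁<…<x_k and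
-- y₁<…<y_k, given by its list of pairs listed in increasing order.
IsAlignment : ℕ → ℕ → List Pair → Set
IsAlignment m₁ m₂ M = All (InRange m₁ m₂) M × Linked Before M

SameSet : List Pair → List Pair → Set
SameSet A B = ∀ p → (p ∈ A) ⇔ (p ∈ B)

-- M can be augmented: some pair (x,y) ∉ M such that M ∪ {(x,y)} is again an
-- alignment (i.e. the set M ∪ {(x,y)}, listed in increasing order, is one).
CanBeAugmented : ℕ → ℕ → List Pair → Set
CanBeAugmented m₁ m₂ M =
  ∃[ p ] (p ∉ M × ∃[ M′ ] (IsAlignment m₁ m₂ M′ × SameSet M′ (p ∷ M)))

-- Columns of the two-row representation.
data Column : Set where
  top   : ℕ → Column        -- letter x of the first string above a skip
  bot   : ℕ → Column        -- skip above letter y of the second string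
  match : ℕ → ℕ → Column    -- matched pair (x , y)

countFrom : ℕ → ℕ → List ℕ
countFrom a zero    = []
countFrom a (suc n) = a ∷ countFrom (suc a) n

-- columns for the gap between previous pair (px,py) and next pair (nx,ny):
-- first unmatched letters px+1..nx-1 of string 1, then py+1..ny-1 of string 2
gap : ℕ → ℕ → ℕ → ℕ → List Column
gap px py nx ny =
  map top (countFrom (suc px) (nx ∸ suc px)) ++
  map bot (countFrom (suc py) (ny ∸ suc py))

representationFrom : ℕ → ℕ → ℕ → ℕ → List Pair → List Column
representationFrom m₁ m₂ px py []            = gap px py (suc m₁) (suc m₂)
representationFrom m₁ m₂ px py ((x , y) ∷ M) =
  gap px py x y ++ match x y ∷ representationFrom m₁ m₂ x y M

-- the conventional representation (x₀ = y₀ = 0, x_{k+1} = m₁+1, y_{k+1} = m₂+1)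
conventionalRepresentation : ℕ → ℕ → List Pair → List Column
conventionalRepresentation m₁ m₂ M = representationFrom m₁ m₂ 0 0 M

ContainsAlternateSkips : List Column → Set
ContainsAlternateSkips cs =
  ∃[ pre ] ∃[ x ] ∃[ y ] ∃[ post ] (cs ≡ pre ++ top x ∷ bot y ∷ post)

-- M can be augmented exactly when some pair p ∈ [m₁] × [m₂] is comparable with every
-- matched pair, and then M ∪ {p} is again a chain. Framing M by the sentinels (0,0) and
-- (m₁+1, m₂+1), such a p exists iff for two consecutive pairs (x,y), (x′,y′) both
-- x+1 < x′ and y+1 < y′, i.e. iff the gap between them leaves an unmatched letter in each
-- string. In the conventional representation this is precisely the gap whose block of
-- letter-over-skip columns is immediately followed by a block of skip-over-letter columns.
module Submission where

open import Defs
open import Data.Nat using (ℕ; zero; suc; _∸_; _<_; _≤_; s≤s; z<s)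
open import Data.Nat.Properties
  using (<-trans; <-irrefl; ≤-<-trans; n<1+n; m<n⇒0<n∸m; m∸n≢0⇒n<m; n>0⇒n≢0)
open import Data.List using (List; []; _∷_; _++_; map)
open import Data.List.Properties using (++-identityʳ)
open import Data.List.Relation.Unary.All as All using (All; []; _∷_)
open import Data.List.Relation.Unary.AllPairs using (AllPairs; []; _∷_)
open import Data.List.Relation.Unary.Any using (here; there)
open import Data.List.Relation.Unary.Linked as Linked using (Linked; []; [-]; _∷_)
open import Data.List.Relation.Unary.Linked.Properties using (Linked⇒All; Linked⇒AllPairs)
open import Data.List.Relation.Binary.Permutation.Propositional using (_↭_; ↭-refl; ↭-prep; ↭-swap; ↭-trans; ↭-sym)
open import Data.List.Relation.Binary.Permutation.Propositional.Properties using (∈-resp-↭; All-resp-↭)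
open import Data.List.Membership.Propositional using (_∈_; _∉_)
open import Data.Product as Product using (_×_; _,_; proj₁; proj₂; ∃-syntax)
open import Data.Sum as Sum using (_⊎_; inj₁; inj₂)
open import Data.Empty using (⊥; ⊥-elim)
open import Data.Unit using (⊤)
open import Relation.Binary.PropositionalEquality using (_≢_; refl; sym; subst)
open import Function.Bundles using (_⇔_; mk⇔; Equivalence)
open import Function.Base using (_∘_)
import Function.Related.Propositional

before-trans : ∀ {p q r} → Before p q → Before q r → Before p r
before-trans (a , b) (c , d) = <-trans a c , <-trans b d

before-irrefl : ∀ {p} → Before p p → ⊥
before-irrefl (a , _) = <-irrefl refl a

Apart : Pair → Pair → Set
Apart p r = Before p r ⊎ Before r p

All-Apart⇒∉ : ∀ {p M} → All (Apart p) M → p ∉ M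
All-Apart⇒∉ aps p∈ = Sum.[ before-irrefl , before-irrefl ] (All.lookup aps p∈)

AllPairs-Before⇒Apart : ∀ {L p r} → AllPairs Before L → p ∈ L → r ∈ L → p ≢ r → Apart p r
AllPairs-Before⇒Apart (_ ∷ _)   (here refl) (here refl) p≢r = ⊥-elim (p≢r refl)
AllPairs-Before⇒Apart (bs ∷ _)  (here refl) (there r∈)  _   = inj₁ (All.lookup bs r∈)
AllPairs-Before⇒Apart (bs ∷ _)  (there p∈)  (here refl) _   = inj₂ (All.lookup bs p∈)
AllPairs-Before⇒Apart (_ ∷ bss) (there p∈)  (there r∈)  p≢r = AllPairs-Before⇒Apart bss p∈ r∈ p≢r

origin : Pair
origin = 0 , 0

ceiling : ℕ → ℕ → Pair
ceiling m₁ m₂ = suc m₁ , suc m₂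

inRange⇒bounded : ∀ {m₁ m₂ p} → InRange m₁ m₂ p → Before origin p × Before p (ceiling m₁ m₂)
inRange⇒bounded ((1≤x , x≤m₁) , (1≤y , y≤m₂)) = (1≤x , 1≤y) , (s≤s x≤m₁ , s≤s y≤m₂)

bounded⇒inRange : ∀ {m₁ m₂ p} → Before origin p → Before p (ceiling m₁ m₂) → InRange m₁ m₂ p
bounded⇒inRange (1≤x , 1≤y) (s≤s x≤m₁ , s≤s y≤m₂) = (1≤x , x≤m₁) , (1≤y , y≤m₂)

linked-from-origin : ∀ {m₁ m₂ M} → All (InRange m₁ m₂) M → Linked Before M → Linked Before (origin ∷ M)
linked-from-origin []      []  = [-]
linked-from-origin (r ∷ _) lnk = proj₁ (inRange⇒bounded r) ∷ lnk

Insertable : ℕ → ℕ → List Pair → Set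
Insertable m₁ m₂ M = ∃[ p ] (InRange m₁ m₂ p × All (Apart p) M)

insert : ∀ {q p M} → Linked Before (q ∷ M) → Before q p → All (Apart p) M →
         ∃[ M′ ] (Linked Before (q ∷ M′) × M′ ↭ p ∷ M)
insert {p = p} _ qp [] = p ∷ [] , qp ∷ [-] , ↭-refl
insert {p = p} {r ∷ M} (_ ∷ lnk) qp (inj₁ pr ∷ _) = p ∷ r ∷ M , qp ∷ pr ∷ lnk , ↭-refl
insert {p = p} {r ∷ M} (qr ∷ lnk) _ (inj₂ rp ∷ aps) with insert lnk rp aps
... | M′ , lnk′ , M′↭ = r ∷ M′ , qr ∷ lnk′ , ↭-trans (↭-prep r M′↭) (↭-swap r p ↭-refl)

canBeAugmented⇒insertable : ∀ {m₁ m₂ M} → CanBeAugmented m₁ m₂ M → Insertable m₁ m₂ M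
canBeAugmented⇒insertable {M = M} (p , p∉M , M′ , (inRange′ , lnk′) , same) =
  p , All.lookup inRange′ p∈M′ , All.tabulate apart
  where
  p∈M′ : p ∈ M′
  p∈M′ = Equivalence.from (same p) (here refl)
  apart : ∀ {r} → r ∈ M → Apart p r
  apart {r} r∈M = AllPairs-Before⇒Apart (Linked⇒AllPairs before-trans lnk′)
    p∈M′ (Equivalence.from (same r) (there r∈M)) λ { refl → p∉M r∈M }

insertable⇒canBeAugmented : ∀ {m₁ m₂ M} → IsAlignment m₁ m₂ M → Insertable m₁ m₂ M → CanBeAugmented m₁ m₂ M
insertable⇒canBeAugmented (inRange , lnk) (p , p-inRange , aps)
  with insert (linked-from-origin inRange lnk) (proj₁ (inRange⇒bounded p-inRange)) aps
... | M′ , lnk′ , M′↭ =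
  p , All-Apart⇒∉ aps , M′ ,
  (All-resp-↭ (↭-sym M′↭) (p-inRange ∷ inRange) , Linked.tail lnk′) ,
  λ r → mk⇔ (∈-resp-↭ M′↭) (∈-resp-↭ (↭-sym M′↭))

next : Pair → Pair
next (x , y) = suc x , suc y

before-next : ∀ p → Before p (next p)
before-next (x , y) = n<1+n x , n<1+n y

between⇒next-before : ∀ {q p r} → Before q p → Before p r → Before (next q) r
between⇒next-before (a , b) (c , d) = ≤-<-trans a c , ≤-<-trans b d

-- FreeGap u q M: in the chain q, M, u some gap between consecutive pairs has room for a pair.
data FreeGap (u : Pair) : Pair → List Pair → Set where
  last  : ∀ {q} → Before (next q) u → FreeGap u q []
  here  : ∀ {q r M} → Before (next q) r → FreeGap u q (r ∷ M)
  there : ∀ {q r M} → FreeGap u r M → FreeGap u q (r ∷ M)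

apart⇒freeGap : ∀ {u q p M} → Before q p → Before p u → All (Apart p) M → FreeGap u q M
apart⇒freeGap qp pu []              = last (between⇒next-before qp pu)
apart⇒freeGap qp pu (inj₁ pr ∷ _)   = here (between⇒next-before qp pr)
apart⇒freeGap qp pu (inj₂ rp ∷ aps) = there (apart⇒freeGap rp pu aps)

freeGap⇒apart : ∀ {u q M} → Linked Before (q ∷ M) → All (λ r → Before r u) M → FreeGap u q M →
                ∃[ p ] (Before q p × Before p u × All (Apart p) M)
freeGap⇒apart {q = q} _ _ (last room) = next q , before-next q , room , []
freeGap⇒apart {q = q} (_ ∷ lnk) (ru ∷ _) (here room) =
  next q , before-next q , before-trans room ru , All.map inj₁ (Linked⇒All before-trans room lnk)
freeGap⇒apart (qr ∷ lnk) (_ ∷ us) (there free) with freeGap⇒apart lnk us free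
... | p , rp , pu , aps = p , before-trans qr rp , pu , inj₂ rp ∷ aps

insertable⇔freeGap : ∀ {m₁ m₂ M} → IsAlignment m₁ m₂ M →
                     Insertable m₁ m₂ M ⇔ FreeGap (ceiling m₁ m₂) origin M
insertable⇔freeGap (inRange , lnk) = mk⇔
  (λ (p , p-inRange , aps) → let op , pc = inRange⇒bounded p-inRange in apart⇒freeGap op pc aps)
  λ free → let p , op , pc , aps = freeGap⇒apart (linked-from-origin inRange lnk)
                                      (All.map (proj₂ ∘ inRange⇒bounded) inRange) free
          in p , bounded⇒inRange op pc , aps

data AlternateSkips : List Column → Set where
  here  : ∀ {x y cs} → AlternateSkips (top x ∷ bot y ∷ cs)
  there : ∀ {c cs} → AlternateSkips cs → AlternateSkips (c ∷ cs)

alternateSkips⇔contains : ∀ cs → AlternateSkips cs ⇔ ContainsAlternateSkips cs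
alternateSkips⇔contains cs = mk⇔ from (to cs)
  where
  to : ∀ cs → ContainsAlternateSkips cs → AlternateSkips cs
  to _ ([]      , x , y , post , refl) = here
  to _ (c ∷ pre , x , y , post , refl) = there (to _ (pre , x , y , post , refl))
  from : ∀ {cs} → AlternateSkips cs → ContainsAlternateSkips cs
  from (here {x} {y} {post}) = [] , x , y , post , refl
  from (there {c} s) with from s
  ... | pre , x , y , post , refl = c ∷ pre , x , y , post , refl

skips-++ˡ : ∀ {xs} ys → AlternateSkips xs → AlternateSkips (xs ++ ys)
skips-++ˡ ys here      = here
skips-++ˡ ys (there s) = there (skips-++ˡ ys s)

skips-++ʳ : ∀ xs {ys} → AlternateSkips ys → AlternateSkips (xs ++ ys)
skips-++ʳ []       s = s
skips-++ʳ (_ ∷ xs) s = there (skips-++ʳ xs s)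

skips-bots-++⁻ : ∀ n b {T} → AlternateSkips (map bot (countFrom b n) ++ T) → AlternateSkips T
skips-bots-++⁻ zero    b s         = s
skips-bots-++⁻ (suc n) b (there s) = skips-bots-++⁻ n (suc b) s

skips-block⁺ : ∀ {n₁ n₂} a b → 0 < n₁ → 0 < n₂ →
               AlternateSkips (map top (countFrom a n₁) ++ map bot (countFrom b n₂))
skips-block⁺ {suc zero}     {suc _} a b _ _ = here
skips-block⁺ {suc (suc n₁)}         a b _ h = there (skips-block⁺ (suc a) b z<s h)

NoLeadingBot : List Column → Set
NoLeadingBot (bot _ ∷ _) = ⊥
NoLeadingBot _           = ⊤

skips-block-++⁻ : ∀ n₁ n₂ a b {T} → NoLeadingBot T →
                  AlternateSkips ((map top (countFrom a n₁) ++ map bot (countFrom b n₂)) ++ T) →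
                  (0 < n₁ × 0 < n₂) ⊎ AlternateSkips T
skips-block-++⁻ zero           n₂       a b _  s         = inj₂ (skips-bots-++⁻ n₂ b s)
skips-block-++⁻ (suc zero)     zero     a b () here
skips-block-++⁻ (suc zero)     zero     a b _  (there s) = inj₂ s
skips-block-++⁻ (suc zero)     (suc n₂) a b _  here      = inj₁ (z<s , z<s)
skips-block-++⁻ (suc zero)     (suc n₂) a b _  (there s) = inj₂ (skips-bots-++⁻ (suc n₂) b s)
skips-block-++⁻ (suc (suc n₁)) n₂       a b nb (there s) =
  Sum.map₁ (Product.map₁ (λ _ → z<s)) (skips-block-++⁻ (suc n₁) n₂ (suc a) b nb s)

0<∸⇒< : ∀ {m n} → 0 < n ∸ m → m < n
0<∸⇒< h = m∸n≢0⇒n<m (n>0⇒n≢0 h)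

gap-skips⁺ : ∀ {px py nx ny} → Before (next (px , py)) (nx , ny) → AlternateSkips (gap px py nx ny)
gap-skips⁺ (a , b) = skips-block⁺ _ _ (m<n⇒0<n∸m a) (m<n⇒0<n∸m b)

gap-skips-++⁻ : ∀ px py nx ny {T} → NoLeadingBot T → AlternateSkips (gap px py nx ny ++ T) →
                Before (next (px , py)) (nx , ny) ⊎ AlternateSkips T
gap-skips-++⁻ px py nx ny nb s =
  Sum.map₁ (Product.map 0<∸⇒< 0<∸⇒<) (skips-block-++⁻ (nx ∸ suc px) (ny ∸ suc py) (suc px) (suc py) nb s)

representation-skips⇒freeGap : ∀ m₁ m₂ px py M → AlternateSkips (representationFrom m₁ m₂ px py M) →
                               FreeGap (ceiling m₁ m₂) (px , py) M
representation-skips⇒freeGap m₁ m₂ px py [] s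
  with gap-skips-++⁻ px py (suc m₁) (suc m₂) _
         (subst AlternateSkips (sym (++-identityʳ _)) s)
... | inj₁ room = last room
representation-skips⇒freeGap m₁ m₂ px py ((x , y) ∷ M) s with gap-skips-++⁻ px py x y _ s
... | inj₁ room      = here room
... | inj₂ (there s) = there (representation-skips⇒freeGap m₁ m₂ x y M s)

freeGap⇒representation-skips : ∀ {m₁ m₂ px py M} → FreeGap (ceiling m₁ m₂) (px , py) M →
                               AlternateSkips (representationFrom m₁ m₂ px py M)
freeGap⇒representation-skips (last room) = gap-skips⁺ room
freeGap⇒representation-skips (here room) = skips-++ˡ _ (gap-skips⁺ room)
freeGap⇒representation-skips {px = px} {py} {(x , y) ∷ _} (there free) =
  skips-++ʳ (gap px py x y) (there (freeGap⇒representation-skips free))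

proposition4 : (m₁ m₂ : ℕ) → 1 ≤ m₁ → 1 ≤ m₂ → (M : List Pair) →
    IsAlignment m₁ m₂ M →
    CanBeAugmented m₁ m₂ M ⇔ ContainsAlternateSkips (conventionalRepresentation m₁ m₂ M)
proposition4 m₁ m₂ _ _ M alignment = begin
  CanBeAugmented m₁ m₂ M
    ∼⟨ mk⇔ canBeAugmented⇒insertable (insertable⇒canBeAugmented alignment) ⟩
  Insertable m₁ m₂ M
    ∼⟨ insertable⇔freeGap alignment ⟩
  FreeGap (ceiling m₁ m₂) origin M
    ∼⟨ mk⇔ freeGap⇒representation-skips (representation-skips⇒freeGap m₁ m₂ 0 0 M) ⟩
  AlternateSkips (conventionalRepresentation m₁ m₂ M)
    ∼⟨ alternateSkips⇔contains _ ⟩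
  ContainsAlternateSkips (conventionalRepresentation m₁ m₂ M) ∎
  where open Function.Related.Propositional.EquationalReasoning
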